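{- For every $n\ge1$ and $\pi\in\mathfrak{S}_n$, \[\sum_{k\ge0}\Omega'^{(\ell)}(\pi;k)\,t^k=\frac{(1+t)^n}{(1-t)^{n+1}}\left(\frac{4t}{(1+t)^2}\right)^{\mathrm{lpe}(\pi)}.\]
   Context: $\mathfrak{S}_n$ is the symmetric group on $[n]$, $\pi=(\pi(1),\dots,\pi(n))$, $\mathrm{Des}(\pi)=\{i\in[n-1]:\pi(i)>\pi(i+1)\}$. With $\pi(0)=\pi(n+1)=0$, a left peak is a position $1\le i<n$ with $\pi(i-1)<\pi(i)>\pi(i+1)$; $\mathrm{lpe}(\pi)$ is the number of left peaks. For $k\ge0$, $[k]^{(\ell)}=\{0,-1,1,-2,2,\dots,-k,k\}$ totally ordered by $0<-1<1<-2<2<\cdots<-k<k$. Write $a\le^+b$ if $a<b$ or $a=b\ge0$, and $a\le^-b$ if $a<b$ or $a=b<0$. $\Omega'^{(\ell)}(\pi;k)$ (left enriched order polynomial) is the number of $(a_1,\dots,a_n)\in([k]^{(\ell)})^n$ with $a_s\le^+a_{s+1}$ for $s\in[n-1]\setminus\mathrm{Des}(\pi)$ and $a_s\le^-a_{s+1}$ for $s\in\mathrm{Des}(\pi)$. -}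

module Defs where

open import Data.Bool using (Bool; true; false; _∧_; _∨_; if_then_else_)
open import Data.Nat as ℕ using (ℕ; zero; suc; _∸_)
open import Data.Nat.Properties as ℕP using ()
open import Data.Integer as ℤ using (ℤ; +_; -_)
open import Data.Integer.Properties as ℤP using ()
open import Data.Fin using (Fin; toℕ; fromℕ<)
open import Data.Fin.Permutation using (Permutation′; _⟨$⟩ʳ_)
open import Data.List using (List; []; _∷_; length; filter; map; concatMap; upTo; foldr)
open import Data.Vec using (Vec; []; _∷_; toList)
open import Relation.Nullary.Decidable using (⌊_⌋; yes; no)
open import Relation.Binary.PropositionalEquality using (_≡_)

infix 4 _<ᵇ_ _<ℤ_ _==ℤ_ _<ℓ_ _≤⁺_ _≤⁻_
infixl 7 _⊛_
infixr 8 _^S_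

_<ᵇ_ : ℕ → ℕ → Bool
m <ᵇ n = ⌊ m ℕ.<? n ⌋

_<ℤ_ : ℤ → ℤ → Bool
a <ℤ b = ⌊ a ℤ.<? b ⌋

_==ℤ_ : ℤ → ℤ → Bool
a ==ℤ b = ⌊ a ℤ.≟ b ⌋

-- Permutations: π ∈ S_n as a permutation of Fin n; position i ∈ [n]
-- corresponds to index i-1, value π(i) = toℕ (π ⟨$⟩ʳ (i-1)) + 1.
-- Extended by π(0) = π(n+1) = 0 (and 0 elsewhere outside [n]).

pval : {n : ℕ} → Permutation′ n → ℕ → ℕ
pval {n} π zero = 0
pval {n} π (suc j) with j ℕ.<? n
... | yes j<n = suc (toℕ (π ⟨$⟩ʳ fromℕ< j<n))
... | no _ = 0

isDes : {n : ℕ} → Permutation′ n → ℕ → Bool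
isDes π s = pval π (suc s) <ᵇ pval π s

range1 : ℕ → List ℕ
range1 m = map suc (upTo m)

isLeftPeak : {n : ℕ} → Permutation′ n → ℕ → Bool
isLeftPeak π i = (pval π (i ∸ 1) <ᵇ pval π i) ∧ (pval π (suc i) <ᵇ pval π i)

lpe : {n : ℕ} → Permutation′ n → ℕ
lpe {n} π = length (filter (λ i → isLeftPeak π i Data.Bool.≟ true) (range1 (n ∸ 1)))

letters : ℕ → List ℤ
letters k = + 0 ∷ concatMap (λ j → - (+ j) ∷ + j ∷ []) (range1 k)

_<ℓ_ : ℤ → ℤ → Bool
a <ℓ b = (ℤ.∣ a ∣ <ᵇ ℤ.∣ b ∣) ∨ (⌊ ℤ.∣ a ∣ ℕ.≟ ℤ.∣ b ∣ ⌋ ∧ (a <ℤ b))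

_≤⁺_ : ℤ → ℤ → Bool
a ≤⁺ b = (a <ℓ b) ∨ ((a ==ℤ b) ∧ ⌊ + 0 ℤ.≤? a ⌋)

_≤⁻_ : ℤ → ℤ → Bool
a ≤⁻ b = (a <ℓ b) ∨ ((a ==ℤ b) ∧ (a <ℤ + 0))

words : {A : Set} → List A → (n : ℕ) → List (Vec A n)
words xs zero = [] ∷ []
words xs (suc n) = concatMap (λ x → map (x ∷_) (words xs n)) xs

-- a_s for s ∈ [n] (1-based), 0 outside
entry : List ℤ → ℕ → ℤ
entry [] _ = + 0
entry (x ∷ xs) zero = + 0
entry (x ∷ xs) (suc zero) = x
entry (x ∷ xs) (suc (suc s)) = entry xs (suc s)

allB : List Bool → Bool
allB = foldr _∧_ true

compatible : {n : ℕ} → Permutation′ n → Vec ℤ n → Bool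
compatible {n} π a =
  allB (map (λ s → if isDes π s
                    then (entry (toList a) s ≤⁻ entry (toList a) (suc s))
                    else (entry (toList a) s ≤⁺ entry (toList a) (suc s)))
            (range1 (n ∸ 1)))

Ωℓ : {n : ℕ} → Permutation′ n → ℕ → ℕ
Ωℓ {n} π k = length (filter (λ a → compatible π a Data.Bool.≟ true) (words (letters k) n))

Series : Set
Series = ℕ → ℤ

_⊛_ : Series → Series → Series
(f ⊛ g) k = foldr ℤ._+_ (+ 0) (map (λ i → f i ℤ.* g (k ∸ i)) (upTo (suc k)))

oneS : Series
oneS zero = + 1
oneS (suc _) = + 0

_^S_ : Series → ℕ → Series
f ^S zero = oneS
f ^S suc m = f ⊛ (f ^S m)

onePlusT : Series
onePlusT zero = + 1
onePlusT (suc zero) = + 1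
onePlusT (suc (suc _)) = + 0

fourT : Series
fourT (suc zero) = + 4
fourT _ = + 0

invOneMinusT : Series
invOneMinusT _ = + 1

invOnePlusT : Series
invOnePlusT zero = + 1
invOnePlusT (suc k) = - invOnePlusT k

rhsSeries : ℕ → ℕ → Series
rhsSeries n m =
  ((onePlusT ^S n) ⊛ (invOneMinusT ^S suc n))
    ⊛ ((fourT ⊛ (invOnePlusT ^S 2)) ^S m)

-- A compatible word is built from its first letter a₁. Given the descent bits
-- d₁ … dₙ₋₁ of π, the number of compatible words whose first letter has rank r,
-- counting the letters of [k]^(ℓ) from the top, does not depend on k, and
-- Ω'^(ℓ)(π;k) is its sum over the 2k+1 ranks. Let E and O be the generating
-- functions of these counts at even ranks (letters ≥ 0) and at odd ranks
-- (letters < 0); then S = Σₖ Ω'^(ℓ)(π;k) tᵏ = (E + O)/(1 − t). Prepending an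
-- ascent to the descent bits gives E′ = S and O′ = tS, so S′ = (1+t)/(1−t) · S.
-- Prepending a descent gives E′ = O′ = tS + O. If the old bits also start with a
-- descent then O = E and again S′ = (1+t)/(1−t) · S; otherwise O = tE, so
-- S = (1+t)/(1−t) · E and S′ = (1+t)/(1−t) · 4t/(1+t)² · S. The descents of the
-- second kind are exactly those starting a maximal run of descents: the left peaks.

module Submission where

open import Defs
open import Data.Nat using (ℕ; _≤_)
open import Data.Integer using (+_)
open import Data.Fin.Permutation using (Permutation′)
open import Relation.Binary.PropositionalEquality using (_≡_)

open import Algebra.Bundles using (CommutativeSemiring)
open import Algebra.Structures.Biased using (isCommutativeSemiringˡ; isCommutativeMonoidˡ)
open import Data.Bool using (Bool; true; false; not; if_then_else_; _∧_)
import Data.Bool as Bool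
open import Data.Bool.Properties using (∧-zeroʳ)
open import Data.Empty using (⊥-elim)
open import Data.Fin using (toℕ; fromℕ<)
import Data.Fin.Properties as Finₚ
open import Data.Fin.Permutation using (_⟨$⟩ʳ_; _⟨$⟩ˡ_; inverseˡ)
open import Data.Integer as ℤ using (ℤ; -[1+_])
import Data.Integer.Properties as ℤₚ
open import Data.Integer.Tactic.RingSolver using (solve-∀)
open import Data.List
  using (List; []; _∷_; _++_; [_]; map; foldr; length; filter; concatMap; upTo; applyUpTo)
open import Data.List.Properties
  using (map-applyUpTo; applyUpTo-∷ʳ; length-applyUpTo; map-++; concatMap-++; ++-identityʳ)
open import Data.Nat.ListAction using (sum)
open import Data.Nat.ListAction.Properties using (sum-++)
open import Data.List.Membership.Propositional using (_∈_)
open import Data.List.Membership.Propositional.Properties using (∈-++⁻)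
open import Data.List.Relation.Unary.Any using (here; there)
open import Data.Nat as ℕ using (zero; suc; _∸_; _<_; z≤n; s≤s)
import Data.Nat.Properties as ℕₚ
open import Data.Nat.Tactic.RingSolver using () renaming (solve-∀ to ℕ-solve-∀)
open import Data.Sum using (_⊎_; inj₁; inj₂)
open import Data.Vec using (Vec; toList) renaming ([] to []ᵥ; _∷_ to _∷ᵥ_)
open import Function using (_∘_; id)
open import Level using (0ℓ)
open import Relation.Binary.PropositionalEquality
  using (_≢_; refl; sym; trans; cong; cong₂; subst; module ≡-Reasoning)
open import Relation.Binary.Structures using (IsEquivalence)
open import Relation.Binary.Definitions using (tri<; tri≈; tri>)
open import Relation.Nullary using (Dec; ¬_; yes; no)
open import Relation.Nullary.Decidable using (⌊_⌋; isYes≗does; dec-true; dec-false)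

-- Formal power series

infix 4 _≈_
_≈_ : Series → Series → Set
f ≈ g = ∀ k → f k ≡ g k

infixl 6 _⊕_
_⊕_ : Series → Series → Series
(f ⊕ g) k = f k ℤ.+ g k

infixr 7 _·_
_·_ : ℤ → Series → Series
(c · f) k = c ℤ.* f k

0S : Series
0S _ = + 0

shift : Series → Series
shift f = f ∘ suc

⊛-suc : ∀ f g k → (f ⊛ g) (suc k) ≡ f 0 ℤ.* g (suc k) ℤ.+ (shift f ⊛ g) k
⊛-suc f g k = cong (λ xs → f 0 ℤ.* g (suc k) ℤ.+ foldr ℤ._+_ (+ 0) xs)
  (trans (map-applyUpTo suc (λ i → f i ℤ.* g (suc k ∸ i)) (suc k))
         (sym (map-applyUpTo id (λ i → f (suc i) ℤ.* g (k ∸ i)) (suc k))))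

⊛-cong : ∀ {f f′ g g′} → f ≈ f′ → g ≈ g′ → f ⊛ g ≈ f′ ⊛ g′
⊛-cong f≈f′ g≈g′ zero = cong₂ (λ a b → a ℤ.* b ℤ.+ + 0) (f≈f′ 0) (g≈g′ 0)
⊛-cong {f} {f′} {g} {g′} f≈f′ g≈g′ (suc k) = begin
  (f ⊛ g) (suc k)                           ≡⟨ ⊛-suc f g k ⟩
  f 0 ℤ.* g (suc k) ℤ.+ (shift f ⊛ g) k     ≡⟨ cong₂ ℤ._+_ (cong₂ ℤ._*_ (f≈f′ 0) (g≈g′ (suc k)))
                                                          (⊛-cong (f≈f′ ∘ suc) g≈g′ k) ⟩
  f′ 0 ℤ.* g′ (suc k) ℤ.+ (shift f′ ⊛ g′) k ≡⟨ ⊛-suc f′ g′ k ⟨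
  (f′ ⊛ g′) (suc k)                         ∎
  where open ≡-Reasoning

⊛-distribʳ : ∀ f g h → (g ⊕ h) ⊛ f ≈ g ⊛ f ⊕ h ⊛ f
⊛-distribʳ f g h zero = ring (g 0) (h 0) (f 0)
  where
  ring : ∀ a b c → (a ℤ.+ b) ℤ.* c ℤ.+ + 0 ≡ a ℤ.* c ℤ.+ + 0 ℤ.+ (b ℤ.* c ℤ.+ + 0)
  ring = solve-∀
⊛-distribʳ f g h (suc k)
  rewrite ⊛-suc (g ⊕ h) f k | ⊛-suc g f k | ⊛-suc h f k | ⊛-distribʳ f (shift g) (shift h) k
  = ring (g 0) (h 0) (f (suc k)) ((shift g ⊛ f) k) ((shift h ⊛ f) k)
  where
  ring : ∀ a b c d e → (a ℤ.+ b) ℤ.* c ℤ.+ (d ℤ.+ e) ≡ a ℤ.* c ℤ.+ d ℤ.+ (b ℤ.* c ℤ.+ e)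
  ring = solve-∀

⊛-scalarˡ : ∀ c f g → (c · f) ⊛ g ≈ c · (f ⊛ g)
⊛-scalarˡ c f g zero = ring c (f 0) (g 0)
  where
  ring : ∀ a b d → a ℤ.* b ℤ.* d ℤ.+ + 0 ≡ a ℤ.* (b ℤ.* d ℤ.+ + 0)
  ring = solve-∀
⊛-scalarˡ c f g (suc k) rewrite ⊛-suc (c · f) g k | ⊛-suc f g k | ⊛-scalarˡ c (shift f) g k
  = ring c (f 0) (g (suc k)) ((shift f ⊛ g) k)
  where
  ring : ∀ a b d e → a ℤ.* b ℤ.* d ℤ.+ a ℤ.* e ≡ a ℤ.* (b ℤ.* d ℤ.+ e)
  ring = solve-∀

⊛-sucʳ : ∀ f g k → (f ⊛ g) (suc k) ≡ f (suc k) ℤ.* g 0 ℤ.+ (f ⊛ shift g) k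
⊛-sucʳ f g zero rewrite ⊛-suc f g 0 = ring (f 0) (g 1) (f 1) (g 0)
  where
  ring : ∀ a b c d → a ℤ.* b ℤ.+ (c ℤ.* d ℤ.+ + 0) ≡ c ℤ.* d ℤ.+ (a ℤ.* b ℤ.+ + 0)
  ring = solve-∀
⊛-sucʳ f g (suc k) rewrite ⊛-suc f g (suc k) | ⊛-sucʳ (shift f) g k | ⊛-suc f (shift g) k
  = ring (f 0) (g (suc (suc k))) (f (suc (suc k))) (g 0) ((shift f ⊛ shift g) k)
  where
  ring : ∀ a b c d e → a ℤ.* b ℤ.+ (c ℤ.* d ℤ.+ e) ≡ c ℤ.* d ℤ.+ (a ℤ.* b ℤ.+ e)
  ring = solve-∀

⊛-comm : ∀ f g → f ⊛ g ≈ g ⊛ f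
⊛-comm f g zero = cong (ℤ._+ + 0) (ℤₚ.*-comm (f 0) (g 0))
⊛-comm f g (suc k) rewrite ⊛-suc f g k | ⊛-sucʳ g f k | ⊛-comm (shift f) g k =
  cong (ℤ._+ (g ⊛ shift f) k) (ℤₚ.*-comm (f 0) (g (suc k)))

⊛-assoc : ∀ f g h → (f ⊛ g) ⊛ h ≈ f ⊛ (g ⊛ h)
⊛-assoc f g h zero = ring (f 0) (g 0) (h 0)
  where
  ring : ∀ a b c → (a ℤ.* b ℤ.+ + 0) ℤ.* c ℤ.+ + 0 ≡ a ℤ.* (b ℤ.* c ℤ.+ + 0) ℤ.+ + 0
  ring = solve-∀
⊛-assoc f g h (suc k) = begin
  ((f ⊛ g) ⊛ h) (suc k)
    ≡⟨ ⊛-suc (f ⊛ g) h k ⟩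
  (f ⊛ g) 0 ℤ.* h (suc k) ℤ.+ (shift (f ⊛ g) ⊛ h) k
    ≡⟨ cong (ℤ._+_ ((f ⊛ g) 0 ℤ.* h (suc k))) tail≡ ⟩
  (f 0 ℤ.* g 0 ℤ.+ + 0) ℤ.* h (suc k) ℤ.+ (f 0 ℤ.* (shift g ⊛ h) k ℤ.+ (shift f ⊛ (g ⊛ h)) k)
    ≡⟨ ring (f 0) (g 0) (h (suc k)) ((shift g ⊛ h) k) ((shift f ⊛ (g ⊛ h)) k) ⟩
  f 0 ℤ.* (g 0 ℤ.* h (suc k) ℤ.+ (shift g ⊛ h) k) ℤ.+ (shift f ⊛ (g ⊛ h)) k
    ≡⟨ cong (λ z → f 0 ℤ.* z ℤ.+ (shift f ⊛ (g ⊛ h)) k) (⊛-suc g h k) ⟨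
  f 0 ℤ.* (g ⊛ h) (suc k) ℤ.+ (shift f ⊛ (g ⊛ h)) k
    ≡⟨ ⊛-suc f (g ⊛ h) k ⟨
  (f ⊛ (g ⊛ h)) (suc k)
    ∎
  where
  open ≡-Reasoning
  ring : ∀ a b c d e → (a ℤ.* b ℤ.+ + 0) ℤ.* c ℤ.+ (a ℤ.* d ℤ.+ e) ≡ a ℤ.* (b ℤ.* c ℤ.+ d) ℤ.+ e
  ring = solve-∀
  tail≡ : (shift (f ⊛ g) ⊛ h) k ≡ f 0 ℤ.* (shift g ⊛ h) k ℤ.+ (shift f ⊛ (g ⊛ h)) k
  tail≡ = begin
    (shift (f ⊛ g) ⊛ h) k                  ≡⟨ ⊛-cong {g = h} (⊛-suc f g) (λ _ → refl) k ⟩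
    ((f 0 · shift g ⊕ shift f ⊛ g) ⊛ h) k  ≡⟨ ⊛-distribʳ h (f 0 · shift g) (shift f ⊛ g) k ⟩
    ((f 0 · shift g) ⊛ h) k ℤ.+ ((shift f ⊛ g) ⊛ h) k
      ≡⟨ cong₂ ℤ._+_ (⊛-scalarˡ (f 0) (shift g) h k) (⊛-assoc (shift f) g h k) ⟩
    f 0 ℤ.* (shift g ⊛ h) k ℤ.+ (shift f ⊛ (g ⊛ h)) k ∎

⊛-zeroˡ : ∀ f → 0S ⊛ f ≈ 0S
⊛-zeroˡ f zero = refl
⊛-zeroˡ f (suc k) = trans (⊛-suc 0S f k) (trans (ℤₚ.+-identityˡ _) (⊛-zeroˡ f k))

⊛-identityˡ : ∀ f → oneS ⊛ f ≈ f
⊛-identityˡ f zero = trans (ℤₚ.+-identityʳ _) (ℤₚ.*-identityˡ (f 0))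
⊛-identityˡ f (suc k) = begin
  (oneS ⊛ f) (suc k)                ≡⟨ ⊛-suc oneS f k ⟩
  + 1 ℤ.* f (suc k) ℤ.+ (0S ⊛ f) k  ≡⟨ cong₂ ℤ._+_ (ℤₚ.*-identityˡ (f (suc k))) (⊛-zeroˡ f k) ⟩
  f (suc k) ℤ.+ + 0                 ≡⟨ ℤₚ.+-identityʳ (f (suc k)) ⟩
  f (suc k)                         ∎
  where open ≡-Reasoning

≈-isEquivalence : IsEquivalence _≈_
≈-isEquivalence = record
  { refl  = λ _ → refl
  ; sym   = λ f≈g k → sym (f≈g k)
  ; trans = λ f≈g g≈h k → trans (f≈g k) (g≈h k)
  }

seriesSemiring : CommutativeSemiring 0ℓ 0ℓ
seriesSemiring = record
  { _+_ = _⊕_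
  ; _*_ = _⊛_
  ; 0# = 0S
  ; 1# = oneS
  ; isCommutativeSemiring = isCommutativeSemiringˡ record
    { +-isCommutativeMonoid = isCommutativeMonoidˡ record
      { isSemigroup = record
        { isMagma = record
          { isEquivalence = ≈-isEquivalence
          ; ∙-cong = λ f≈f′ g≈g′ k → cong₂ ℤ._+_ (f≈f′ k) (g≈g′ k)
          }
        ; assoc = λ f g h k → ℤₚ.+-assoc (f k) (g k) (h k)
        }
      ; identityˡ = λ f k → ℤₚ.+-identityˡ (f k)
      ; comm = λ f g k → ℤₚ.+-comm (f k) (g k)
      }
    ; *-isCommutativeMonoid = isCommutativeMonoidˡ record
      { isSemigroup = record
        { isMagma = record { isEquivalence = ≈-isEquivalence ; ∙-cong = ⊛-cong }
        ; assoc = ⊛-assoc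
        }
      ; identityˡ = ⊛-identityˡ
      ; comm = ⊛-comm
      }
    ; distribʳ = ⊛-distribʳ
    ; zeroˡ = ⊛-zeroˡ
    }
  }

open CommutativeSemiring seriesSemiring public
  using (setoid; +-cong; +-congˡ; +-congʳ; *-cong; *-congˡ; *-congʳ)
  renaming (refl to ≈-refl; sym to ≈-sym; trans to ≈-trans)
open import Algebra.Solver.Ring.NaturalCoefficients.Default seriesSemiring
  using (solve; _:+_; _:*_; _:=_; con)

X : Series
X (suc zero) = + 1
X _          = + 0

I J P Q : Series
I = invOneMinusT
J = invOnePlusT
P = onePlusT
Q = fourT ⊛ (invOnePlusT ^S 2)

X⊛-suc : ∀ f k → (X ⊛ f) (suc k) ≡ f k
X⊛-suc f k = begin
  (X ⊛ f) (suc k)                       ≡⟨ ⊛-suc X f k ⟩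
  + 0 ℤ.* f (suc k) ℤ.+ (shift X ⊛ f) k ≡⟨ ℤₚ.+-identityˡ _ ⟩
  (shift X ⊛ f) k                       ≡⟨ ⊛-cong {g = f} shiftX≈1 (λ _ → refl) k ⟩
  (oneS ⊛ f) k                          ≡⟨ ⊛-identityˡ f k ⟩
  f k                                   ∎
  where
  open ≡-Reasoning
  shiftX≈1 : shift X ≈ oneS
  shiftX≈1 zero    = refl
  shiftX≈1 (suc _) = refl

P≈1⊕X : P ≈ oneS ⊕ X
P≈1⊕X zero          = refl
P≈1⊕X (suc zero)    = refl
P≈1⊕X (suc (suc _)) = refl

fourT≈4X : fourT ≈ X ⊕ X ⊕ X ⊕ X
fourT≈4X zero          = refl
fourT≈4X (suc zero)    = refl
fourT≈4X (suc (suc _)) = refl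

I≈X⊛I⊕1 : I ≈ X ⊛ I ⊕ oneS
I≈X⊛I⊕1 zero    = refl
I≈X⊛I⊕1 (suc k) = sym (cong (ℤ._+ + 0) (X⊛-suc I k))

J⊛P≈1 : J ⊛ P ≈ oneS
J⊛P≈1 = begin
  J ⊛ P                ≈⟨ *-congˡ {J} P≈1⊕X ⟩
  J ⊛ (oneS ⊕ X)       ≈⟨ solve 2 (λ j x → j :* (con 1 :+ x) := j :+ x :* j) ≈-refl J X ⟩
  J ⊕ X ⊛ J            ≈⟨ alternating ⟩
  oneS                 ∎
  where
  open import Relation.Binary.Reasoning.Setoid setoid
  alternating : J ⊕ X ⊛ J ≈ oneS
  alternating zero    = refl
  alternating (suc k) = trans (cong (ℤ._+_ (J (suc k))) (X⊛-suc J k)) (ℤₚ.+-inverseˡ (J k))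

g≈X⊛g⊕f⇒g≈I⊛f : ∀ {f g} → g ≈ X ⊛ g ⊕ f → g ≈ I ⊛ f
g≈X⊛g⊕f⇒g≈I⊛f {f} {g} g≈ zero =
  trans (g≈ 0) (trans (ℤₚ.+-identityˡ (f 0)) (sym (trans (ℤₚ.+-identityʳ _) (ℤₚ.*-identityˡ (f 0)))))
g≈X⊛g⊕f⇒g≈I⊛f {f} {g} g≈ (suc k) = begin
  g (suc k)                        ≡⟨ g≈ (suc k) ⟩
  (X ⊛ g) (suc k) ℤ.+ f (suc k)    ≡⟨ cong (ℤ._+ f (suc k)) (X⊛-suc g k) ⟩
  g k ℤ.+ f (suc k)                ≡⟨ cong (ℤ._+ f (suc k)) (g≈X⊛g⊕f⇒g≈I⊛f g≈ k) ⟩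
  (I ⊛ f) k ℤ.+ f (suc k)          ≡⟨ ℤₚ.+-comm _ (f (suc k)) ⟩
  f (suc k) ℤ.+ (I ⊛ f) k          ≡⟨ cong (ℤ._+ (I ⊛ f) k) (ℤₚ.*-identityˡ (f (suc k))) ⟨
  + 1 ℤ.* f (suc k) ℤ.+ (I ⊛ f) k  ≡⟨ ⊛-suc I f k ⟨
  (I ⊛ f) (suc k)                  ∎
  where open ≡-Reasoning

rhs-grow : ∀ {f} n m → f ≈ rhsSeries n m → P ⊛ (I ⊛ f) ≈ rhsSeries (suc n) m
rhs-grow {f} n m f≈ = ≈-trans (*-congˡ {P} (*-congˡ {I} f≈))
  (solve 5 (λ p pⁿ i iⁿ qᵐ → p :* (i :* ((pⁿ :* iⁿ) :* qᵐ)) := ((p :* pⁿ) :* (i :* iⁿ)) :* qᵐ)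
     ≈-refl P (P ^S n) I (I ^S suc n) (Q ^S m))

rhs-peak : ∀ {f} n m → f ≈ rhsSeries n m → Q ⊛ (P ⊛ (I ⊛ f)) ≈ rhsSeries (suc n) (suc m)
rhs-peak {f} n m f≈ = ≈-trans (*-congˡ {Q} (*-congˡ {P} (*-congˡ {I} f≈)))
  (solve 6 (λ p pⁿ i iⁿ q qᵐ → q :* (p :* (i :* ((pⁿ :* iⁿ) :* qᵐ))) := ((p :* pⁿ) :* (i :* iⁿ)) :* (q :* qᵐ))
     ≈-refl P (P ^S n) I (I ^S suc n) Q (Q ^S m))

I≈rhs₀₀ : I ≈ rhsSeries 0 0
I≈rhs₀₀ = solve 1 (λ i → i := (con 1 :* (i :* con 1)) :* con 1) ≈-refl I

count : {A : Set} → (A → Bool) → List A → ℕ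
count p []       = 0
count p (x ∷ xs) = (if p x then 1 else 0) ℕ.+ count p xs

length-filter≡count : ∀ {A : Set} (p : A → Bool) xs →
                      length (filter (λ a → p a Bool.≟ true) xs) ≡ count p xs
length-filter≡count p []       = refl
length-filter≡count p (x ∷ xs) with p x
... | true  = cong suc (length-filter≡count p xs)
... | false = length-filter≡count p xs

count-++ : ∀ {A : Set} (p : A → Bool) xs ys → count p (xs ++ ys) ≡ count p xs ℕ.+ count p ys
count-++ p []       ys = refl
count-++ p (x ∷ xs) ys = trans (cong (_ ℕ.+_) (count-++ p xs ys))
                               (sym (ℕₚ.+-assoc (if p x then 1 else 0) (count p xs) (count p ys)))

count-concatMap : ∀ {A B : Set} (p : B → Bool) (f : A → List B) xs →
                  count p (concatMap f xs) ≡ sum (map (count p ∘ f) xs)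
count-concatMap p f []       = refl
count-concatMap p f (x ∷ xs) =
  trans (count-++ p (f x) (concatMap f xs)) (cong (_ ℕ.+_) (count-concatMap p f xs))

count-map : ∀ {A B : Set} (p : B → Bool) (f : A → B) xs → count p (map f xs) ≡ count (p ∘ f) xs
count-map p f []       = refl
count-map p f (x ∷ xs) = cong (_ ℕ.+_) (count-map p f xs)

count-cong : ∀ {A : Set} {p q : A → Bool} → (∀ a → p a ≡ q a) → ∀ xs → count p xs ≡ count q xs
count-cong p≗q []       = refl
count-cong p≗q (x ∷ xs) = cong₂ ℕ._+_ (cong (λ b → if b then 1 else 0) (p≗q x)) (count-cong p≗q xs)

count-∧ : ∀ {A : Set} b (p : A → Bool) xs → count (λ a → b ∧ p a) xs ≡ (if b then count p xs else 0)
count-∧ true  p xs       = refl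
count-∧ false p []       = refl
count-∧ false p (x ∷ xs) = count-∧ false p xs

sum-map-++ : ∀ {A : Set} (f : A → ℕ) xs ys → sum (map f (xs ++ ys)) ≡ sum (map f xs) ℕ.+ sum (map f ys)
sum-map-++ f xs ys = trans (cong sum (map-++ f xs ys)) (sum-++ (map f xs) (map f ys))

sum-map-cong : ∀ {A : Set} {f g : A → ℕ} xs → (∀ {x} → x ∈ xs → f x ≡ g x) →
               sum (map f xs) ≡ sum (map g xs)
sum-map-cong []       f≗g = refl
sum-map-cong (x ∷ xs) f≗g = cong₂ ℕ._+_ (f≗g (here refl)) (sum-map-cong xs (f≗g ∘ there))

sum-map-zero : ∀ {A : Set} {f : A → ℕ} xs → (∀ {x} → x ∈ xs → f x ≡ 0) → sum (map f xs) ≡ 0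
sum-map-zero []       f≗0 = refl
sum-map-zero (x ∷ xs) f≗0 = cong₂ ℕ._+_ (f≗0 (here refl)) (sum-map-zero xs (f≗0 ∘ there))

-- The alphabet [k]^(ℓ)

range1-suc : ∀ k → range1 (suc k) ≡ range1 k ++ [ suc k ]
range1-suc k = trans (cong (map suc) (sym (applyUpTo-∷ʳ id k))) (map-++ suc (upTo k) [ k ])

letters-suc : ∀ k → letters (suc k) ≡ letters k ++ -[1+ k ] ∷ + suc k ∷ []
letters-suc k = cong (+ 0 ∷_) (begin
  concatMap pair (range1 (suc k))                       ≡⟨ cong (concatMap pair) (range1-suc k) ⟩
  concatMap pair (range1 k ++ [ suc k ])                ≡⟨ concatMap-++ pair (range1 k) [ suc k ] ⟩
  concatMap pair (range1 k) ++ pair (suc k) ++ []       ≡⟨ cong (concatMap pair (range1 k) ++_) (++-identityʳ _) ⟩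
  concatMap pair (range1 k) ++ -[1+ k ] ∷ + suc k ∷ []  ∎)
  where
  open ≡-Reasoning
  pair : ℕ → List ℤ
  pair j = ℤ.- (+ j) ∷ + j ∷ []

∈-letters-suc : ∀ {k x} → x ∈ letters (suc k) → x ∈ letters k ⊎ x ≡ -[1+ k ] ⊎ x ≡ + suc k
∈-letters-suc {k} {x} x∈ with ∈-++⁻ (letters k) (subst (x ∈_) (letters-suc k) x∈)
... | inj₁ x∈ₖ                 = inj₁ x∈ₖ
... | inj₂ (here x≡)           = inj₂ (inj₁ x≡)
... | inj₂ (there (here x≡))   = inj₂ (inj₂ x≡)
... | inj₂ (there (there ()))

∣∣≤-letters : ∀ {k x} → x ∈ letters k → ℤ.∣ x ∣ ℕ.≤ k
∣∣≤-letters {zero}  (here refl) = z≤n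
∣∣≤-letters {suc k} x∈ with ∈-letters-suc {k} x∈
... | inj₁ x∈ₖ         = ℕₚ.m≤n⇒m≤1+n (∣∣≤-letters x∈ₖ)
... | inj₂ (inj₁ refl) = ℕₚ.≤-refl
... | inj₂ (inj₂ refl) = ℕₚ.≤-refl

double : ℕ → ℕ
double zero    = zero
double (suc m) = suc (suc (double m))

-- Position counted from the top: k ↦ 0, -k ↦ 1, k-1 ↦ 2, …, 0 ↦ 2k, so
-- nonnegative letters have even rank.
rank : ℕ → ℤ → ℕ
rank k (+ a)    = double (k ∸ a)
rank k -[1+ a ] = suc (double (k ∸ suc a))

rank-suc : ∀ {k} x → ℤ.∣ x ∣ ℕ.≤ k → rank (suc k) x ≡ suc (suc (rank k x))
rank-suc (+ a)    a≤k  rewrite ℕₚ.+-∸-assoc 1 a≤k  = refl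
rank-suc -[1+ a ] a<k rewrite ℕₚ.+-∸-assoc 1 a<k = refl

⌊⌋-true : ∀ {A : Set} (a? : Dec A) → A → ⌊ a? ⌋ ≡ true
⌊⌋-true a? a = trans (isYes≗does a?) (dec-true a? a)

⌊⌋-false : ∀ {A : Set} (a? : Dec A) → ¬ A → ⌊ a? ⌋ ≡ false
⌊⌋-false a? ¬a = trans (isYes≗does a?) (dec-false a? ¬a)

related : Bool → ℤ → ℤ → Bool
related d x y = if d then x ≤⁻ y else x ≤⁺ y

related-if : ∀ d {x y} → (x <ℓ y) ≡ true → related d x y ≡ true
related-if false x<y rewrite x<y = refl
related-if true  x<y rewrite x<y = refl

related-below : ∀ d {x y} → ℤ.∣ x ∣ < ℤ.∣ y ∣ → related d x y ≡ true
related-below d {x} {y} ∣x∣<∣y∣ = related-if d {x} {y}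
  (cong (Bool._∨ (⌊ ℤ.∣ x ∣ ℕ.≟ ℤ.∣ y ∣ ⌋ ∧ (x <ℤ y))) (⌊⌋-true (ℤ.∣ x ∣ ℕ.<? ℤ.∣ y ∣) ∣x∣<∣y∣))

related-above : ∀ d {x y} → ℤ.∣ y ∣ < ℤ.∣ x ∣ → related d x y ≡ false
related-above d {x} {y} ∣y∣<∣x∣
  rewrite ⌊⌋-false (ℤ.∣ x ∣ ℕ.<? ℤ.∣ y ∣) (ℕₚ.<⇒≯ ∣y∣<∣x∣)
        | ⌊⌋-false (ℤ.∣ x ∣ ℕ.≟ ℤ.∣ y ∣) (ℕₚ.>⇒≢ ∣y∣<∣x∣)
        | ⌊⌋-false (x ℤ.≟ y) (λ x≡y → ℕₚ.>⇒≢ ∣y∣<∣x∣ (cong ℤ.∣_∣ x≡y))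
  with d
... | false = refl
... | true  = refl

<ℓ-irrefl : ∀ x → (x <ℓ x) ≡ false
<ℓ-irrefl x
  rewrite ⌊⌋-false (ℤ.∣ x ∣ ℕ.<? ℤ.∣ x ∣) (ℕₚ.n≮n _)
        | ⌊⌋-true (ℤ.∣ x ∣ ℕ.≟ ℤ.∣ x ∣) refl
        | ⌊⌋-false (x ℤ.<? x) (ℤₚ.<-irrefl refl) = refl

related-refl : ∀ d x → related d x x ≡ (if d then x <ℤ + 0 else ⌊ + 0 ℤ.≤? x ⌋)
related-refl d x rewrite <ℓ-irrefl x | ⌊⌋-true (x ℤ.≟ x) refl with d
... | false = refl
... | true  = refl

related-top⁻⁺ : ∀ d k → related d -[1+ k ] (+ suc k) ≡ true
related-top⁻⁺ d k = related-if d { -[1+ k ] } {+ suc k}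
  (cong₂ Bool._∨_ (⌊⌋-false (suc k ℕ.<? suc k) (ℕₚ.n≮n _))
                  (cong (Bool._∧ _) (⌊⌋-true (suc k ℕ.≟ suc k) refl)))

related-top⁺⁻ : ∀ d k → related d (+ suc k) -[1+ k ] ≡ false
related-top⁺⁻ d k
  rewrite ⌊⌋-false (suc k ℕ.<? suc k) (ℕₚ.n≮n _) | ⌊⌋-true (suc k ℕ.≟ suc k) refl
  with d
... | false = refl
... | true  = refl

related-top⁻⁻ : ∀ d k → related d -[1+ k ] -[1+ k ] ≡ d
related-top⁻⁻ false k = related-refl false -[1+ k ]
related-top⁻⁻ true  k = related-refl true -[1+ k ]

related-top⁺⁺ : ∀ d k → related d (+ suc k) (+ suc k) ≡ not d
related-top⁺⁺ false k = related-refl false (+ suc k)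
related-top⁺⁺ true  k = related-refl true (+ suc k)

prefixSum : (ℕ → ℕ) → ℕ → ℕ
prefixSum f zero    = 0
prefixSum f (suc r) = prefixSum f r ℕ.+ f r

prefixSum-suc-suc : ∀ f r → prefixSum f (suc (suc r)) ≡ f 0 ℕ.+ f 1 ℕ.+ prefixSum (f ∘ suc ∘ suc) r
prefixSum-suc-suc f zero    = sym (ℕₚ.+-identityʳ _)
prefixSum-suc-suc f (suc r) rewrite prefixSum-suc-suc f r = ℕₚ.+-assoc (f 0 ℕ.+ f 1) _ _

-- Whether a step of type d (true for a descent) may repeat a letter of rank r:
-- ≤⁺ allows it for letters ≥ 0 (even rank), ≤⁻ for letters < 0 (odd rank).
tieAllowed : Bool → ℕ → Bool
tieAllowed d zero          = not d
tieAllowed d (suc zero)    = d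
tieAllowed d (suc (suc r)) = tieAllowed d r

chainStep : Bool → (ℕ → ℕ) → ℕ → ℕ
chainStep d f r = prefixSum f r ℕ.+ (if tieAllowed d r then f r else 0)

chains : List Bool → ℕ → ℕ
chains []       _ = 1
chains (d ∷ ds)   = chainStep d (chains ds)

chainStep-suc-suc : ∀ d f r → chainStep d f (suc (suc r)) ≡ f 0 ℕ.+ f 1 ℕ.+ chainStep d (f ∘ suc ∘ suc) r
chainStep-suc-suc d f r = trans (cong (ℕ._+ tie) (prefixSum-suc-suc f r))
                                (ℕₚ.+-assoc (f 0 ℕ.+ f 1) (prefixSum (f ∘ suc ∘ suc) r) tie)
  where
  tie : ℕ
  tie = if tieAllowed d r then f (suc (suc r)) else 0

sum-letters-suc : ∀ k (g : ℤ → ℕ) →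
  sum (map g (letters (suc k))) ≡ g (+ suc k) ℕ.+ g -[1+ k ] ℕ.+ sum (map g (letters k))
sum-letters-suc k g = begin
  sum (map g (letters (suc k)))                                     ≡⟨ cong (sum ∘ map g) (letters-suc k) ⟩
  sum (map g (letters k ++ -[1+ k ] ∷ + suc k ∷ []))                ≡⟨ sum-map-++ g (letters k) _ ⟩
  sum (map g (letters k)) ℕ.+ (g -[1+ k ] ℕ.+ (g (+ suc k) ℕ.+ 0))  ≡⟨ regroup _ (g -[1+ k ]) (g (+ suc k)) ⟩
  g (+ suc k) ℕ.+ g -[1+ k ] ℕ.+ sum (map g (letters k))           ∎
  where
  open ≡-Reasoning
  regroup : ∀ a b c → a ℕ.+ (b ℕ.+ (c ℕ.+ 0)) ≡ c ℕ.+ b ℕ.+ a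
  regroup = ℕ-solve-∀

sum-related-letters : ∀ k d (f : ℕ → ℕ) {x} → x ∈ letters k →
  sum (map (λ y → if related d x y then f (rank k y) else 0) (letters k)) ≡ chainStep d f (rank k x)
sum-related-letters zero false f (here refl) = ℕₚ.+-identityʳ (f 0)
sum-related-letters zero true  f (here refl) = refl
sum-related-letters (suc k) d f {x} x∈ =
  trans (sum-letters-suc k (λ y → if related d x y then f (rank (suc k) y) else 0))
        (cases (∈-letters-suc x∈))
  where
  below-top : ∀ x → ℤ.∣ x ∣ ≡ suc k →
              sum (map (λ y → if related d x y then f (rank (suc k) y) else 0) (letters k)) ≡ 0
  below-top x ∣x∣≡1+k = sum-map-zero (letters k) λ {y} y∈ →
    cong (λ b → if b then f (rank (suc k) y) else 0)
         (related-above d {x} {y} (subst (ℤ.∣ y ∣ <_) (sym ∣x∣≡1+k) (s≤s (∣∣≤-letters y∈))))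
  cases : ∀ {x} → x ∈ letters k ⊎ x ≡ -[1+ k ] ⊎ x ≡ + suc k →
    let g = λ y → if related d x y then f (rank (suc k) y) else 0 in
    g (+ suc k) ℕ.+ g -[1+ k ] ℕ.+ sum (map g (letters k)) ≡ chainStep d f (rank (suc k) x)
  cases {x} (inj₁ x∈ₖ) = begin
    g (+ suc k) ℕ.+ g -[1+ k ] ℕ.+ sum (map g (letters k))  ≡⟨ cong₂ ℕ._+_ top old ⟩
    f 0 ℕ.+ f 1 ℕ.+ chainStep d (f ∘ suc ∘ suc) (rank k x) ≡⟨ chainStep-suc-suc d f (rank k x) ⟨
    chainStep d f (suc (suc (rank k x)))                   ≡⟨ cong (chainStep d f) (rank-suc x ∣x∣≤k) ⟨
    chainStep d f (rank (suc k) x)                         ∎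
    where
    open ≡-Reasoning
    ∣x∣≤k : ℤ.∣ x ∣ ℕ.≤ k
    ∣x∣≤k = ∣∣≤-letters x∈ₖ
    g : ℤ → ℕ
    g y = if related d x y then f (rank (suc k) y) else 0
    top : g (+ suc k) ℕ.+ g -[1+ k ] ≡ f 0 ℕ.+ f 1
    top rewrite related-below d {x} {+ suc k} (s≤s ∣x∣≤k)
              | related-below d { x } { -[1+ k ] } (s≤s ∣x∣≤k)
              | ℕₚ.n∸n≡0 k = refl
    old : sum (map g (letters k)) ≡ chainStep d (f ∘ suc ∘ suc) (rank k x)
    old = trans (sum-map-cong (letters k) λ {y} y∈ →
                   cong (λ r → if related d x y then f r else 0) (rank-suc y (∣∣≤-letters y∈)))
                (sum-related-letters k d (f ∘ suc ∘ suc) x∈ₖ)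
  cases (inj₂ (inj₁ refl))
    rewrite below-top -[1+ k ] refl
          | related-top⁻⁺ d k | related-top⁻⁻ d k | ℕₚ.n∸n≡0 k = ℕₚ.+-identityʳ _
  cases (inj₂ (inj₂ refl))
    rewrite below-top (+ suc k) refl
          | related-top⁺⁺ d k | related-top⁺⁻ d k | ℕₚ.n∸n≡0 k
    = trans (ℕₚ.+-identityʳ _) (ℕₚ.+-identityʳ _)

sum-letters : ∀ k (f : ℕ → ℕ) → sum (map (f ∘ rank k) (letters k)) ≡ prefixSum f (suc (double k))
sum-letters zero    f = ℕₚ.+-identityʳ (f 0)
sum-letters (suc k) f
  rewrite sum-letters-suc k (f ∘ rank (suc k)) | ℕₚ.n∸n≡0 k
        | prefixSum-suc-suc f (suc (double k))
  = cong (f 0 ℕ.+ f 1 ℕ.+_) (trans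
      (sum-map-cong (letters k) λ {y} y∈ → cong f (rank-suc y (∣∣≤-letters y∈)))
      (sum-letters k (f ∘ suc ∘ suc)))

-- Compatible words

chainOK : List Bool → List ℤ → Bool
chainOK (d ∷ ds) (x ∷ y ∷ ys) = related d x y ∧ chainOK ds (y ∷ ys)
chainOK _        _            = true

count-chainOK : ∀ k ds {x} → x ∈ letters k →
  count (λ w → chainOK ds (x ∷ toList w)) (words (letters k) (length ds)) ≡ chains ds (rank k x)
count-chainOK k []       x∈ = refl
count-chainOK k (d ∷ ds) {x} x∈ = begin
  count (λ w → chainOK (d ∷ ds) (x ∷ toList w)) (concatMap (λ y → map (y ∷ᵥ_) W) L)
    ≡⟨ count-concatMap _ (λ y → map (y ∷ᵥ_) W) L ⟩
  sum (map (λ y → count (λ w → chainOK (d ∷ ds) (x ∷ toList w)) (map (y ∷ᵥ_) W)) L)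
    ≡⟨ sum-map-cong L (λ {y} y∈ → begin
         count (λ w → chainOK (d ∷ ds) (x ∷ toList w)) (map (y ∷ᵥ_) W)
           ≡⟨ count-map _ (y ∷ᵥ_) W ⟩
         count (λ w → related d x y ∧ chainOK ds (y ∷ toList w)) W
           ≡⟨ count-∧ (related d x y) _ W ⟩
         (if related d x y then count (λ w → chainOK ds (y ∷ toList w)) W else 0)
           ≡⟨ cong (λ c → if related d x y then c else 0) (count-chainOK k ds y∈) ⟩
         (if related d x y then chains ds (rank k y) else 0) ∎) ⟩
  sum (map (λ y → if related d x y then chains ds (rank k y) else 0) L)
    ≡⟨ sum-related-letters k d (chains ds) x∈ ⟩
  chains (d ∷ ds) (rank k x) ∎
  where
  open ≡-Reasoning
  L : List ℤ
  L = letters k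
  W : List (Vec ℤ (length ds))
  W = words L (length ds)

descents : ∀ {n} → Permutation′ n → List Bool
descents {n} π = applyUpTo (isDes π ∘ suc) (n ∸ 1)

compatible-applyUpTo : ∀ (g : ℕ → Bool) m x (ys : Vec ℤ m) →
  let xs = x ∷ toList ys in
  allB (applyUpTo (λ i → related (g (suc i)) (entry xs (suc i)) (entry xs (suc (suc i)))) m)
    ≡ chainOK (applyUpTo (g ∘ suc) m) xs
compatible-applyUpTo g zero    x []ᵥ       = refl
compatible-applyUpTo g (suc m) x (y ∷ᵥ ys) =
  cong (related (g 1) x y ∧_) (compatible-applyUpTo (g ∘ suc) m y ys)

compatible≡chainOK : ∀ {m} (π : Permutation′ (suc m)) (a : Vec ℤ (suc m)) →
  compatible π a ≡ chainOK (descents π) (toList a)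
compatible≡chainOK {m} π (x ∷ᵥ ys) = trans
  (cong allB (trans (cong (map link) (map-applyUpTo id suc m)) (map-applyUpTo suc link m)))
  (compatible-applyUpTo (isDes π) m x ys)
  where
  link : ℕ → Bool
  link s = related (isDes π s) (entry (x ∷ toList ys) s) (entry (x ∷ toList ys) (suc s))

Ωℓ≡prefixSum-chains : ∀ {m} (π : Permutation′ (suc m)) k →
  Ωℓ π k ≡ prefixSum (chains (descents π)) (suc (double k))
Ωℓ≡prefixSum-chains {m} π k = begin
  Ωℓ π k
    ≡⟨ length-filter≡count (compatible π) (words L (suc m)) ⟩
  count (compatible π) (words L (suc m))
    ≡⟨ count-cong (compatible≡chainOK π) (words L (suc m)) ⟩
  count (λ a → chainOK ds (toList a)) (concatMap (λ x → map (x ∷ᵥ_) (words L m)) L)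
    ≡⟨ count-concatMap _ (λ x → map (x ∷ᵥ_) (words L m)) L ⟩
  sum (map (λ x → count (λ a → chainOK ds (toList a)) (map (x ∷ᵥ_) (words L m))) L)
    ≡⟨ sum-map-cong L (λ x∈ → count-map _ (_ ∷ᵥ_) (words L m)) ⟩
  sum (map (λ x → count (λ w → chainOK ds (x ∷ toList w)) (words L m)) L)
    ≡⟨ cong (λ n → sum (map (λ x → count (λ w → chainOK ds (x ∷ toList w)) (words L n)) L))
            (length-applyUpTo (isDes π ∘ suc) m) ⟨
  sum (map (λ x → count (λ w → chainOK ds (x ∷ toList w)) (words L (length ds))) L)
    ≡⟨ sum-map-cong L (count-chainOK k ds) ⟩
  sum (map (chains ds ∘ rank k) L)
    ≡⟨ sum-letters k (chains ds) ⟩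
  prefixSum (chains ds) (suc (double k)) ∎
  where
  open ≡-Reasoning
  L : List ℤ
  L = letters k
  ds : List Bool
  ds = descents π

-- Left peaks

runStarts : Bool → List Bool → ℕ
runStarts b []       = 0
runStarts b (d ∷ ds) = (if not b ∧ d then 1 else 0) ℕ.+ runStarts d ds

count≡runStarts : ∀ (g : ℕ → Bool) m →
  count (λ i → not (g i) ∧ g (suc i)) (upTo m) ≡ runStarts (g 0) (applyUpTo (g ∘ suc) m)
count≡runStarts g zero    = refl
count≡runStarts g (suc m) = cong (_ ℕ.+_) (begin
  count starts (applyUpTo suc m)        ≡⟨ cong (count starts) (map-applyUpTo id suc m) ⟨
  count starts (map suc (upTo m))       ≡⟨ count-map starts suc (upTo m) ⟩
  count (starts ∘ suc) (upTo m)         ≡⟨ count≡runStarts (g ∘ suc) m ⟩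
  runStarts (g 1) (applyUpTo (g ∘ suc ∘ suc) m) ∎)
  where
  open ≡-Reasoning
  starts : ℕ → Bool
  starts i = not (g i) ∧ g (suc i)

<ᵇ-flip : ∀ {a b} → a ≢ b → (a <ᵇ b) ≡ not (b <ᵇ a)
<ᵇ-flip {a} {b} a≢b with ℕₚ.<-cmp a b
... | tri< a<b _ b≮a rewrite ⌊⌋-true (a ℕ.<? b) a<b | ⌊⌋-false (b ℕ.<? a) b≮a = refl
... | tri≈ _ a≡b _   = ⊥-elim (a≢b a≡b)
... | tri> a≮b _ b<a rewrite ⌊⌋-true (b ℕ.<? a) b<a | ⌊⌋-false (a ℕ.<? b) a≮b = refl

pval-suc< : ∀ {n} (π : Permutation′ n) {j} (j<n : j < n) →
            pval π (suc j) ≡ suc (toℕ (π ⟨$⟩ʳ fromℕ< j<n))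
pval-suc< {n} π {j} j<n with j ℕ.<? n
... | yes _   = refl
... | no j≮n  = ⊥-elim (j≮n j<n)

pval-suc≮ : ∀ {n} (π : Permutation′ n) {j} → ¬ j < n → pval π (suc j) ≡ 0
pval-suc≮ {n} π {j} j≮n with j ℕ.<? n
... | yes j<n = ⊥-elim (j≮n j<n)
... | no _    = refl

pval-adjacent : ∀ {n} (π : Permutation′ n) i → pval π (suc i) ≡ 0 ⊎ pval π i ≢ pval π (suc i)
pval-adjacent {n} π i = split (i ℕ.<? n)
  where
  injective : ∀ {a b} → π ⟨$⟩ʳ a ≡ π ⟨$⟩ʳ b → a ≡ b
  injective {a} {b} πa≡πb = trans (sym (inverseˡ π)) (trans (cong (π ⟨$⟩ˡ_) πa≡πb) (inverseˡ π))
  distinct : ∀ i (i<n : i < n) → pval π i ≢ pval π (suc i)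
  distinct zero    i<n 0≡ = ℕₚ.0≢1+n (trans 0≡ (pval-suc< π i<n))
  distinct (suc j) i<n eq = ℕₚ.1+n≢n (sym (begin
    j                              ≡⟨ Finₚ.toℕ-fromℕ< j<n ⟨
    toℕ (fromℕ< j<n)               ≡⟨ cong toℕ (injective (Finₚ.toℕ-injective (ℕₚ.suc-injective (begin
      suc (toℕ (π ⟨$⟩ʳ fromℕ< j<n)) ≡⟨ pval-suc< π j<n ⟨
      pval π (suc j)               ≡⟨ eq ⟩
      pval π (suc (suc j))         ≡⟨ pval-suc< π i<n ⟩
      suc (toℕ (π ⟨$⟩ʳ fromℕ< i<n)) ∎)))) ⟩
    toℕ (fromℕ< i<n)               ≡⟨ Finₚ.toℕ-fromℕ< i<n ⟩
    suc j                          ∎))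
    where
    open ≡-Reasoning
    j<n : j < n
    j<n = ℕₚ.<-trans (ℕₚ.n<1+n j) i<n
  split : Dec (i < n) → pval π (suc i) ≡ 0 ⊎ pval π i ≢ pval π (suc i)
  split (no i≮n)  = inj₁ (pval-suc≮ π i≮n)
  split (yes i<n) = inj₂ (distinct i i<n)

isLeftPeak-suc : ∀ {n} (π : Permutation′ n) i →
                 isLeftPeak π (suc i) ≡ not (isDes π i) ∧ isDes π (suc i)
isLeftPeak-suc π i with pval-adjacent π i
... | inj₁ vᵢ₊₁≡0 rewrite vᵢ₊₁≡0 = sym (∧-zeroʳ _)
... | inj₂ vᵢ≢vᵢ₊₁ = cong (_∧ isDes π (suc i)) (<ᵇ-flip vᵢ≢vᵢ₊₁)

lpe≡runStarts : ∀ {m} (π : Permutation′ (suc m)) → lpe π ≡ runStarts false (descents π)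
lpe≡runStarts {m} π = begin
  lpe π                                                     ≡⟨ length-filter≡count (isLeftPeak π) (range1 m) ⟩
  count (isLeftPeak π) (map suc (upTo m))                   ≡⟨ count-map (isLeftPeak π) suc (upTo m) ⟩
  count (isLeftPeak π ∘ suc) (upTo m)                       ≡⟨ count-cong (isLeftPeak-suc π) (upTo m) ⟩
  count (λ i → not (isDes π i) ∧ isDes π (suc i)) (upTo m)  ≡⟨ count≡runStarts (isDes π) m ⟩
  runStarts (isDes π 0) (descents π)                        ≡⟨⟩
  runStarts false (descents π)                              ∎
  where open ≡-Reasoning

-- Generating functions

evenGF oddGF ΩGF : List Bool → Series
evenGF ds m       = + chains ds (double m)
oddGF  ds zero    = + 0
oddGF  ds (suc m) = + chains ds (suc (double m))
ΩGF    ds m       = + prefixSum (chains ds) (suc (double m))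

tieAllowed-even : ∀ d m → tieAllowed d (double m) ≡ not d
tieAllowed-even d zero    = refl
tieAllowed-even d (suc m) = tieAllowed-even d m

tieAllowed-odd : ∀ d m → tieAllowed d (suc (double m)) ≡ d
tieAllowed-odd d zero    = refl
tieAllowed-odd d (suc m) = tieAllowed-odd d m

prefixSum-even : ∀ ds m → + prefixSum (chains ds) (double m) ≡ (X ⊛ ΩGF ds ⊕ oddGF ds) m
prefixSum-even ds zero    = refl
prefixSum-even ds (suc m) = cong (ℤ._+ oddGF ds (suc m)) (sym (X⊛-suc (ΩGF ds) m))

ΩGF-split : ∀ ds → ΩGF ds ≈ X ⊛ ΩGF ds ⊕ (evenGF ds ⊕ oddGF ds)
ΩGF-split ds zero    = cong +_ (sym (ℕₚ.+-identityʳ (chains ds 0)))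
ΩGF-split ds (suc m) = trans (cong (ℤ._+ evenGF ds (suc m)) (prefixSum-even ds (suc m)))
                             (ring ((X ⊛ ΩGF ds) (suc m)) (oddGF ds (suc m)) (evenGF ds (suc m)))
  where
  ring : ∀ a b c → a ℤ.+ b ℤ.+ c ≡ a ℤ.+ (c ℤ.+ b)
  ring = solve-∀

evenGF-ascent : ∀ ds → evenGF (false ∷ ds) ≈ ΩGF ds
evenGF-ascent ds m rewrite tieAllowed-even false m = refl

oddGF-ascent : ∀ ds → oddGF (false ∷ ds) ≈ X ⊛ ΩGF ds
oddGF-ascent ds zero    = refl
oddGF-ascent ds (suc m) rewrite tieAllowed-odd false m | X⊛-suc (ΩGF ds) m = ℤₚ.+-identityʳ _

evenGF-descent : ∀ ds → evenGF (true ∷ ds) ≈ X ⊛ ΩGF ds ⊕ oddGF ds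
evenGF-descent ds m rewrite tieAllowed-even true m = trans (ℤₚ.+-identityʳ _) (prefixSum-even ds m)

oddGF-descent : ∀ ds → oddGF (true ∷ ds) ≈ X ⊛ ΩGF ds ⊕ oddGF ds
oddGF-descent ds zero    = refl
oddGF-descent ds (suc m) rewrite tieAllowed-odd true m =
  cong (ℤ._+ oddGF ds (suc m)) (sym (X⊛-suc (ΩGF ds) m))

oddGF-[] : oddGF [] ≈ X ⊛ evenGF []
oddGF-[] zero    = refl
oddGF-[] (suc m) = sym (X⊛-suc (evenGF []) m)

oddGF-after-ascent : ∀ ds → oddGF (false ∷ ds) ≈ X ⊛ evenGF (false ∷ ds)
oddGF-after-ascent ds = ≈-trans (oddGF-ascent ds) (*-congˡ {X} (≈-sym (evenGF-ascent ds)))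

oddGF-after-descent : ∀ ds → oddGF (true ∷ ds) ≈ evenGF (true ∷ ds)
oddGF-after-descent ds = ≈-trans (oddGF-descent ds) (≈-sym (evenGF-descent ds))

module _ where
  open import Relation.Binary.Reasoning.Setoid setoid

  ΩGF≈I⊛[even⊕odd] : ∀ ds → ΩGF ds ≈ I ⊛ (evenGF ds ⊕ oddGF ds)
  ΩGF≈I⊛[even⊕odd] ds = g≈X⊛g⊕f⇒g≈I⊛f (ΩGF-split ds)

  ΩGF-from-even : ∀ ds → oddGF ds ≈ X ⊛ evenGF ds → ΩGF ds ≈ P ⊛ (I ⊛ evenGF ds)
  ΩGF-from-even ds odd≈ = begin
    ΩGF ds                ≈⟨ ΩGF≈I⊛[even⊕odd] ds ⟩
    I ⊛ (E ⊕ oddGF ds)    ≈⟨ *-congˡ {I} (+-congˡ {E} odd≈) ⟩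
    I ⊛ (E ⊕ X ⊛ E)       ≈⟨ solve 3 (λ i x e → i :* (e :+ x :* e) := (con 1 :+ x) :* (i :* e)) ≈-refl I X E ⟩
    (oneS ⊕ X) ⊛ (I ⊛ E)  ≈⟨ *-congʳ {I ⊛ E} P≈1⊕X ⟨
    P ⊛ (I ⊛ E)           ∎
    where
    E : Series
    E = evenGF ds

  ΩGF-ascent : ∀ ds → ΩGF (false ∷ ds) ≈ P ⊛ (I ⊛ ΩGF ds)
  ΩGF-ascent ds = begin
    ΩGF (false ∷ ds)              ≈⟨ ΩGF-from-even (false ∷ ds) (oddGF-after-ascent ds) ⟩
    P ⊛ (I ⊛ evenGF (false ∷ ds)) ≈⟨ *-congˡ {P} (*-congˡ {I} (evenGF-ascent ds)) ⟩
    P ⊛ (I ⊛ ΩGF ds)              ∎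

  ΩGF-descent : ∀ ds → ΩGF (true ∷ ds) ≈ I ⊛ ((X ⊛ ΩGF ds ⊕ oddGF ds) ⊕ (X ⊛ ΩGF ds ⊕ oddGF ds))
  ΩGF-descent ds = begin
    ΩGF (true ∷ ds)                               ≈⟨ ΩGF≈I⊛[even⊕odd] (true ∷ ds) ⟩
    I ⊛ (evenGF (true ∷ ds) ⊕ oddGF (true ∷ ds))  ≈⟨ *-congˡ {I} (+-cong (evenGF-descent ds) (oddGF-descent ds)) ⟩
    I ⊛ ((X ⊛ ΩGF ds ⊕ oddGF ds) ⊕ (X ⊛ ΩGF ds ⊕ oddGF ds)) ∎

  ΩGF-double-descent : ∀ ds → oddGF ds ≈ evenGF ds → ΩGF (true ∷ ds) ≈ P ⊛ (I ⊛ ΩGF ds)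
  ΩGF-double-descent ds odd≈even = begin
    ΩGF (true ∷ ds)                  ≈⟨ ΩGF-descent ds ⟩
    I ⊛ ((X ⊛ S ⊕ O) ⊕ (X ⊛ S ⊕ O))  ≈⟨ *-congˡ {I} (+-congˡ {X ⊛ S ⊕ O} (+-congˡ {X ⊛ S} odd≈even)) ⟩
    I ⊛ ((X ⊛ S ⊕ O) ⊕ (X ⊛ S ⊕ E))
      ≈⟨ solve 5 (λ i x s o e → i :* ((x :* s :+ o) :+ (x :* s :+ e))
                                := i :* (x :* s :+ (x :* s :+ (e :+ o)))) ≈-refl I X S O E ⟩
    I ⊛ (X ⊛ S ⊕ (X ⊛ S ⊕ (E ⊕ O)))  ≈⟨ *-congˡ {I} (+-congˡ {X ⊛ S} (ΩGF-split ds)) ⟨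
    I ⊛ (X ⊛ S ⊕ S)                  ≈⟨ solve 3 (λ i x s → i :* (x :* s :+ s) := (con 1 :+ x) :* (i :* s))
                                               ≈-refl I X S ⟩
    (oneS ⊕ X) ⊛ (I ⊛ S)             ≈⟨ *-congʳ {I ⊛ S} P≈1⊕X ⟨
    P ⊛ (I ⊛ S)                      ∎
    where
    S E O : Series
    S = ΩGF ds
    E = evenGF ds
    O = oddGF ds

  ΩGF-peak : ∀ ds → oddGF ds ≈ X ⊛ evenGF ds → ΩGF (true ∷ ds) ≈ Q ⊛ (P ⊛ (I ⊛ ΩGF ds))
  ΩGF-peak ds odd≈ = begin
    ΩGF (true ∷ ds)                          ≈⟨ ΩGF-descent ds ⟩
    I ⊛ ((X ⊛ S ⊕ O) ⊕ (X ⊛ S ⊕ O))          ≈⟨ *-congˡ {I} (+-cong (+-congˡ {X ⊛ S} odd≈) (+-congˡ {X ⊛ S} odd≈)) ⟩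
    I ⊛ ((X ⊛ S ⊕ X ⊛ E) ⊕ (X ⊛ S ⊕ X ⊛ E))
      ≈⟨ solve 4 (λ i x s e → i :* ((x :* s :+ x :* e) :+ (x :* s :+ x :* e))
                              := (x :+ x) :* (i :* (s :+ e))) ≈-refl I X S E ⟩
    (X ⊕ X) ⊛ (I ⊛ (S ⊕ E))                  ≈⟨ *-congˡ {X ⊕ X} (*-congˡ {I} S⊕E≈2IE) ⟩
    (X ⊕ X) ⊛ (I ⊛ ((I ⊕ I) ⊛ E))
      ≈⟨ solve 3 (λ i x e → (x :+ x) :* (i :* ((i :+ i) :* e))
                            := (x :+ x :+ x :+ x) :* (i :* (i :* e))) ≈-refl I X E ⟩
    (X ⊕ X ⊕ X ⊕ X) ⊛ (I ⊛ (I ⊛ E))          ≈⟨ Q-side ⟨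
    Q ⊛ (P ⊛ (I ⊛ S))                        ∎
    where
    S E O : Series
    S = ΩGF ds
    E = evenGF ds
    O = oddGF ds
    S⊕E≈2IE : S ⊕ E ≈ (I ⊕ I) ⊛ E
    S⊕E≈2IE = begin
      S ⊕ E                        ≈⟨ +-congʳ {E} (ΩGF-from-even ds odd≈) ⟩
      P ⊛ (I ⊛ E) ⊕ E              ≈⟨ +-congʳ {E} (*-congʳ {I ⊛ E} P≈1⊕X) ⟩
      (oneS ⊕ X) ⊛ (I ⊛ E) ⊕ E     ≈⟨ solve 3 (λ i x e → (con 1 :+ x) :* (i :* e) :+ e
                                                         := i :* e :+ (x :* i :+ con 1) :* e) ≈-refl I X E ⟩
      I ⊛ E ⊕ (X ⊛ I ⊕ oneS) ⊛ E   ≈⟨ +-congˡ {I ⊛ E} (*-congʳ {E} I≈X⊛I⊕1) ⟨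
      I ⊛ E ⊕ I ⊛ E                ≈⟨ solve 2 (λ i e → i :* e :+ i :* e := (i :+ i) :* e) ≈-refl I E ⟩
      (I ⊕ I) ⊛ E                  ∎
    Q-side : Q ⊛ (P ⊛ (I ⊛ S)) ≈ (X ⊕ X ⊕ X ⊕ X) ⊛ (I ⊛ (I ⊛ E))
    Q-side = begin
      Q ⊛ (P ⊛ (I ⊛ S))                              ≈⟨ *-congˡ {Q} (*-congˡ {P} (*-congˡ {I} (ΩGF-from-even ds odd≈))) ⟩
      Q ⊛ (P ⊛ (I ⊛ (P ⊛ (I ⊛ E))))
        ≈⟨ solve 5 (λ f j p i e → (f :* (j :* (j :* con 1))) :* (p :* (i :* (p :* (i :* e))))
                                  := ((j :* p) :* (j :* p)) :* (f :* (i :* (i :* e)))) ≈-refl fourT J P I E ⟩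
      ((J ⊛ P) ⊛ (J ⊛ P)) ⊛ (fourT ⊛ (I ⊛ (I ⊛ E)))  ≈⟨ *-congʳ {fourT ⊛ (I ⊛ (I ⊛ E))} (*-cong J⊛P≈1 J⊛P≈1) ⟩
      (oneS ⊛ oneS) ⊛ (fourT ⊛ (I ⊛ (I ⊛ E)))
        ≈⟨ solve 3 (λ f i e → (con 1 :* con 1) :* (f :* (i :* (i :* e))) := f :* (i :* (i :* e)))
                 ≈-refl fourT I E ⟩
      fourT ⊛ (I ⊛ (I ⊛ E))                          ≈⟨ *-congʳ {I ⊛ (I ⊛ E)} fourT≈4X ⟩
      (X ⊕ X ⊕ X ⊕ X) ⊛ (I ⊛ (I ⊛ E))                ∎

ΩGF≈rhs : ∀ ds → ΩGF ds ≈ rhsSeries (suc (length ds)) (runStarts false ds)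
ΩGF≈rhs [] = ≈-trans (ΩGF-from-even [] oddGF-[]) (rhs-grow 0 0 I≈rhs₀₀)
ΩGF≈rhs (false ∷ ds) =
  ≈-trans (ΩGF-ascent ds) (rhs-grow (suc (length ds)) (runStarts false ds) (ΩGF≈rhs ds))
ΩGF≈rhs (true ∷ []) = ≈-trans (ΩGF-peak [] oddGF-[]) (rhs-peak 1 0 (ΩGF≈rhs []))
ΩGF≈rhs (true ∷ false ∷ ds) =
  ≈-trans (ΩGF-peak (false ∷ ds) (oddGF-after-ascent ds))
          (rhs-peak (suc (suc (length ds))) (runStarts false ds) (ΩGF≈rhs (false ∷ ds)))
ΩGF≈rhs (true ∷ true ∷ ds) =
  ≈-trans (ΩGF-double-descent (true ∷ ds) (oddGF-after-descent ds))
          (rhs-grow (suc (suc (length ds))) (runStarts false (true ∷ ds)) (ΩGF≈rhs (true ∷ ds)))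

theorem4p6 : (n : ℕ) → 1 ≤ n → (π : Permutation′ n) →
    (k : ℕ) → + (Ωℓ π k) ≡ rhsSeries n (lpe π) k
theorem4p6 zero    ()
theorem4p6 (suc m) _  π k = begin
  + Ωℓ π k                                            ≡⟨ cong +_ (Ωℓ≡prefixSum-chains π k) ⟩
  ΩGF ds k                                            ≡⟨ ΩGF≈rhs ds k ⟩
  rhsSeries (suc (length ds)) (runStarts false ds) k  ≡⟨ cong₂ (λ n p → rhsSeries (suc n) p k)
                                                              (length-applyUpTo (isDes π ∘ suc) m)
                                                              (sym (lpe≡runStarts π)) ⟩
  rhsSeries (suc m) (lpe π) k                         ∎
  where
  open ≡-Reasoning
  ds : List Bool
  ds = descents π
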